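{- Let $G$ be an $\alpha$-separable graph with $m$ edges and let $\mathcal{T}$ be a separator tree of $G$. Let $\mathcal{H}$ be a set of $K$ nodes in $\mathcal{T}$. Then \[\sum_{H\in\mathcal{P}_{\mathcal{T}}(\mathcal{H})}|\partial H|+|S(H)|\le\widetilde{O}(K^{1-\alpha}m^{\alpha}).\]
   Context: A graph $G$ is $\alpha$-separable if there exist constants $c>0$ and $b\in(0,1)$ such that every nonempty subgraph $H$ with $|E(H)|\ge2$ can be partitioned into $H_1,H_2$ with $E(H_1)\cup E(H_2)=E(H)$, $E(H_1)\cap E(H_2)=\emptyset$, $|V(H_1)\cap V(H_2)|\le c\lceil|E(H)|^\alpha\rceil$, and $|E(H_i)|\le b|E(H)|$; $S(H)=V(H_1)\cap V(H_2)$ is the balanced vertex separator. A separator tree $\mathcal{T}$ is a rooted binary tree whose nodes are regions (edge-induced subgraphs) $H$ with vertex sets $\partial H,S(H),F_H$: the root is $G$ with $\partial G=\emptyset$, $F_G=S(G)$; a non-leaf $H$ has two children $D_1,D_2$ forming such a partition of $H$ with $V(D_1)\cap V(D_2)=S(H)$, $\partial D_j=(\partial H\cup S(H))\cap V(D_j)$, $F_H=S(H)\setminus\partial H$; a region with a constant number of edges is a leaf with $S(H)=\emptyset$, $F_H=V(H)\setminus\partial H$ (so the height is $O(\log m)$). For a set $\mathcal{H}$ of nodes, $\mathcal{P}_{\mathcal{T}}(\mathcal{H})$ is the set of all nodes on the tree paths from nodes of $\mathcal{H}$ to the root, including the nodes of $\mathcal{H}$. $\widetilde{O}$ hides polylogarithmic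 factors in $m$.
   Formalization: The exponent α of α-separability ranges only over the rationals strictly between 0 and 1. -}

module Defs where

open import Data.Nat using (ℕ; zero; suc; _+_; _*_; _^_; _≤_; _<_)
open import Data.Bool using (Bool; true; false; if_then_else_)
open import Data.Fin using (Fin)
open import Data.Fin.Subset using (Subset; ⊥; ⊤; _∪_; _∩_; ∣_∣; ⁅_⁆)
open import Data.Vec using (lookup)
open import Data.List using (List; []; _∷_; mapMaybe; allFin; foldr)
open import Data.Maybe using (Maybe; just; nothing)
open import Data.Product using (_×_; _,_; ∃-syntax; proj₁; proj₂)
open import Relation.Binary.PropositionalEquality using (_≡_)

record Graph : Set where
  field
    n    : ℕ
    m    : ℕ
    ends : Fin m → Fin n × Fin n
open Graph public

-- Edge-induced subgraphs (regions) are given by their edge sets.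
EdgeSet : Graph → Set
EdgeSet G = Subset (m G)

VertSet : Graph → Set
VertSet G = Subset (n G)

V : (G : Graph) → EdgeSet G → VertSet G
V G H = foldr step ⊥ (allFin (m G))
  where
  step : Fin (m G) → VertSet G → VertSet G
  step e acc = (if lookup H e
                then ⁅ proj₁ (ends G e) ⁆ ∪ ⁅ proj₂ (ends G e) ⁆
                else ⊥) ∪ acc

-- Exponent α = p / q (rational, 0 < p < q).
-- SepBound p q c e s  :⇔  s ≤ c * ⌈ e ^ (p/q) ⌉,
-- expressed as: s ≤ c * t for every natural t with t ≥ e^(p/q), i.e. t^q ≥ e^p
-- (the least such t is exactly ⌈ e^(p/q) ⌉).
SepBound : (p q c e s : ℕ) → Set
SepBound p q c e s = ∀ (t : ℕ) → e ^ p ≤ t ^ q → s ≤ c * t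

Sep : (G : Graph) → EdgeSet G → EdgeSet G → VertSet G
Sep G D₁ D₂ = V G D₁ ∩ V G D₂

-- D₁, D₂ is a balanced split of H with constants c and b = bn / bd.
IsSplit : (G : Graph) (p q c bn bd : ℕ) (H D₁ D₂ : EdgeSet G) → Set
IsSplit G p q c bn bd H D₁ D₂ =
  (D₁ ∪ D₂ ≡ H) × (D₁ ∩ D₂ ≡ ⊥) ×
  SepBound p q c ∣ H ∣ ∣ Sep G D₁ D₂ ∣ ×
  (bd * ∣ D₁ ∣ ≤ bn * ∣ H ∣) × (bd * ∣ D₂ ∣ ≤ bn * ∣ H ∣)

Separable : (G : Graph) (p q c bn bd : ℕ) → Set
Separable G p q c bn bd =
  ∀ (H : EdgeSet G) → 2 ≤ ∣ H ∣ → ∃[ D₁ ] ∃[ D₂ ] IsSplit G p q c bn bd H D₁ D₂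

-- Separator tree: a node is a region H (edge set) together with its boundary ∂H.
-- Leaves are exactly the regions with at most L edges (L the constant).
data SepTree (G : Graph) (p q c bn bd L : ℕ) : (H : EdgeSet G) (∂ : VertSet G) → Set where
  leaf : ∀ {H ∂} → ∣ H ∣ ≤ L → SepTree G p q c bn bd L H ∂
  node : ∀ {H ∂} (D₁ D₂ : EdgeSet G) → L < ∣ H ∣ → IsSplit G p q c bn bd H D₁ D₂ →
         SepTree G p q c bn bd L D₁ ((∂ ∪ Sep G D₁ D₂) ∩ V G D₁) →
         SepTree G p q c bn bd L D₂ ((∂ ∪ Sep G D₁ D₂) ∩ V G D₂) →
         SepTree G p q c bn bd L H ∂

module _ {G : Graph} {p q c bn bd L : ℕ} where

  -- Nodes of a separator tree, as positions (paths from the root).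
  data Pos : ∀ {H ∂} → SepTree G p q c bn bd L H ∂ → Set where
    here  : ∀ {H ∂} {T : SepTree G p q c bn bd L H ∂} → Pos T
    left  : ∀ {H ∂ D₁ D₂ lt sp} {T₁ : SepTree G p q c bn bd L D₁ _} {T₂ : SepTree G p q c bn bd L D₂ _} →
            Pos T₁ → Pos (node {H = H} {∂ = ∂} D₁ D₂ lt sp T₁ T₂)
    right : ∀ {H ∂ D₁ D₂ lt sp} {T₁ : SepTree G p q c bn bd L D₁ _} {T₂ : SepTree G p q c bn bd L D₂ _} →
            Pos T₂ → Pos (node {H = H} {∂ = ∂} D₁ D₂ lt sp T₁ T₂)

  private
    goLeft : ∀ {H ∂ D₁ D₂ lt sp} {T₁ : SepTree G p q c bn bd L D₁ _} {T₂ : SepTree G p q c bn bd L D₂ _} →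
             Pos (node {H = H} {∂ = ∂} D₁ D₂ lt sp T₁ T₂) → Maybe (Pos T₁)
    goLeft here      = nothing
    goLeft (left x)  = just x
    goLeft (right _) = nothing

    goRight : ∀ {H ∂ D₁ D₂ lt sp} {T₁ : SepTree G p q c bn bd L D₁ _} {T₂ : SepTree G p q c bn bd L D₂ _} →
              Pos (node {H = H} {∂ = ∂} D₁ D₂ lt sp T₁ T₂) → Maybe (Pos T₂)
    goRight here      = nothing
    goRight (left _)  = nothing
    goRight (right x) = just x

  -- Σ_{H ∈ P_T(𝓗)} (|∂H| + |S(H)|), where P_T(𝓗) is the set of nodes lying on a
  -- path from a node of 𝓗 to the root (each such node counted once).
  -- For a leaf S(H) = ∅; for an internal node S(H) = V(D₁) ∩ V(D₂).
  pathCost : ∀ {H ∂} (T : SepTree G p q c bn bd L H ∂) → List (Pos T) → ℕ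
  pathCost T [] = 0
  pathCost {∂ = ∂} (leaf _) (_ ∷ _) = ∣ ∂ ∣ + 0
  pathCost {∂ = ∂} (node D₁ D₂ lt sp T₁ T₂) hs@(_ ∷ _) =
    ∣ ∂ ∣ + ∣ Sep G D₁ D₂ ∣ + pathCost T₁ (mapMaybe goLeft hs) + pathCost T₂ (mapMaybe goRight hs)

-- The boundary of a child lies in ∂H ∪ S(H), and the boundaries of the two children
-- of H overlap only inside S(H); hence, with h the height of the tree, the cost is at
-- most (h+1)·2·Σ|S(H)|, summed over the internal nodes of 𝓟_T(𝓗). Group these nodes by
-- r = ⌊log₂|E(H)|⌋: class r has N_r ≤ hK members of total size 2^r·N_r ≤ hm (each level of
-- the tree partitions E(G)), and each separator has size at most c·2^t with t·q ≈ (r+1)p.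
-- So (c·2^t·N_r)^q ≤ c^q 2^(p+q) N_r^(q-p) (2^r N_r)^p ≤ c^q 2^(p+q) (hK)^(q-p) (hm)^p.
-- Summing over the ℓ = 1+⌊log₂ m⌋ classes and using h ≤ bn·ℓ (region sizes shrink by a
-- factor bn/bd per level, and (1+1/bn)^bn ≥ 2) gives the bound with the factor ℓ^(3q).

module Submission where

open import Defs
open import Data.Nat using (ℕ; zero; suc; _+_; _*_; _^_; _∸_; _≤_; _<_; _⊔_; z≤n; s≤s; NonZero; >-nonZero; >-nonZero⁻¹; ⌊_/2⌋; ⌈_/2⌉)
open import Data.Nat.Properties
open import Data.Nat.DivMod using (_/_; _%_; m≡m%n+[m/n]*n; m%n<n; m/n*n≤m)
open import Data.Nat.Logarithm using (⌊log₂_⌋; ⌊log₂⌋-mono-≤; ⌊log₂[2^n]⌋≡n)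
open import Data.Nat.Logarithm.Core using (⌊log2⌋)
open import Data.Nat.ListAction using (sum)
open import Data.Nat.ListAction.Properties using (sum-++)
open import Data.Nat.Tactic.RingSolver using (solve-∀)
open import Data.Vec using ([]; _∷_)
open import Data.Fin.Subset using (Subset; inside; outside; ⊤; ⊥; _∪_; _∩_; ∣_∣; _⊆_)
open import Data.Fin.Subset.Properties using (∣⊥∣≡0; ∣⊤∣≡n; ∣p∣≤n; p⊆q⇒∣p∣≤∣q∣; p∩q⊆p; x∈p∩q⁺; x∈p∩q⁻; x∈p∪q⁻)
open import Data.List using (List; []; _∷_; _++_; length; filter; map; mapMaybe)
open import Data.List.Properties using (length-++; length-filter; filter-accept; filter-reject; map-++; mapMaybe-cong)
open import Data.List.Relation.Unary.All as All using (All; []; _∷_)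
open import Data.List.Relation.Unary.All.Properties using (++⁺)
open import Data.List.Relation.Unary.Unique.Propositional using (Unique)
open import Data.Maybe using (Maybe; just; nothing)
open import Data.Product using (_×_; _,_; ∃-syntax; proj₁; proj₂)
open import Data.Sum using (inj₁; inj₂; [_,_]′)
open import Induction.WellFounded using (Acc; acc)
open import Relation.Binary.PropositionalEquality
open import Relation.Nullary using (yes; no; ¬_)

-- Arithmetic

^-distribʳ-* : ∀ m n o → (m * n) ^ o ≡ m ^ o * n ^ o
^-distribʳ-* m n zero    = refl
^-distribʳ-* m n (suc o) = begin
  m * n * (m * n) ^ o      ≡⟨ cong (m * n *_) (^-distribʳ-* m n o) ⟩
  m * n * (m ^ o * n ^ o)  ≡⟨ interchange m n (m ^ o) (n ^ o) ⟩
  m * m ^ o * (n * n ^ o)  ∎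
  where
  open ≡-Reasoning
  interchange : ∀ a b x y → a * b * (x * y) ≡ a * x * (b * y)
  interchange = solve-∀

^-∸-split : ∀ x {p q} → p ≤ q → x ^ (q ∸ p) * x ^ p ≡ x ^ q
^-∸-split x {p} {q} p≤q = trans (sym (^-distribˡ-+-* x (q ∸ p) p)) (cong (x ^_) (m∸n+n≡m p≤q))

[x*y]^[q∸p]*[x*z]^p : ∀ x y z {p q} → p ≤ q → (x * y) ^ (q ∸ p) * (x * z) ^ p ≡ x ^ q * (y ^ (q ∸ p) * z ^ p)
[x*y]^[q∸p]*[x*z]^p x y z {p} {q} p≤q = begin
  (x * y) ^ (q ∸ p) * (x * z) ^ p                   ≡⟨ cong₂ _*_ (^-distribʳ-* x y (q ∸ p)) (^-distribʳ-* x z p) ⟩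
  x ^ (q ∸ p) * y ^ (q ∸ p) * (x ^ p * z ^ p)       ≡⟨ interchange (x ^ (q ∸ p)) (y ^ (q ∸ p)) (x ^ p) (z ^ p) ⟩
  x ^ (q ∸ p) * x ^ p * (y ^ (q ∸ p) * z ^ p)       ≡⟨ cong (_* (y ^ (q ∸ p) * z ^ p)) (^-∸-split x p≤q) ⟩
  x ^ q * (y ^ (q ∸ p) * z ^ p)                     ∎
  where
  open ≡-Reasoning
  interchange : ∀ a b c d → a * b * (c * d) ≡ a * c * (b * d)
  interchange = solve-∀

height-elimination : ∀ q κ b ℓ h y z → h ≤ b * ℓ → 0 < ℓ →
  suc h ^ q * (2 ^ q * (ℓ ^ q * (κ * (h ^ q * (y * z))))) ≤ suc b ^ q * 2 ^ q * κ * b ^ q * y * z * ℓ ^ (q + q + q)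
height-elimination q κ b ℓ h y z h≤bℓ 0<ℓ = begin
  suc h ^ q * (2 ^ q * (ℓ ^ q * (κ * (h ^ q * (y * z)))))
    ≤⟨ *-mono-≤ (^-monoˡ-≤ q 1+h≤) (*-monoʳ-≤ (2 ^ q) (*-monoʳ-≤ (ℓ ^ q) (*-monoʳ-≤ κ (*-monoˡ-≤ (y * z) (^-monoˡ-≤ q h≤bℓ))))) ⟩
  (suc b * ℓ) ^ q * (2 ^ q * (ℓ ^ q * (κ * ((b * ℓ) ^ q * (y * z)))))
    ≡⟨ cong₂ (λ u v → u * (2 ^ q * (ℓ ^ q * (κ * (v * (y * z)))))) (^-distribʳ-* (suc b) ℓ q) (^-distribʳ-* b ℓ q) ⟩
  suc b ^ q * ℓ ^ q * (2 ^ q * (ℓ ^ q * (κ * (b ^ q * ℓ ^ q * (y * z)))))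
    ≡⟨ regroup (suc b ^ q) (ℓ ^ q) (2 ^ q) κ (b ^ q) y z ⟩
  suc b ^ q * 2 ^ q * κ * b ^ q * y * z * (ℓ ^ q * ℓ ^ q * ℓ ^ q)
    ≡⟨ cong (suc b ^ q * 2 ^ q * κ * b ^ q * y * z *_) ℓ^[q+q+q] ⟨
  suc b ^ q * 2 ^ q * κ * b ^ q * y * z * ℓ ^ (q + q + q)
    ∎
  where
  open ≤-Reasoning
  1+h≤ : suc h ≤ suc b * ℓ
  1+h≤ = +-mono-≤ 0<ℓ h≤bℓ
  ℓ^[q+q+q] : ℓ ^ (q + q + q) ≡ ℓ ^ q * ℓ ^ q * ℓ ^ q
  ℓ^[q+q+q] = trans (^-distribˡ-+-* ℓ (q + q) q) (cong (_* ℓ ^ q) (^-distribˡ-+-* ℓ q q))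
  regroup : ∀ s L t κ β y z → s * L * (t * (L * (κ * (β * L * (y * z))))) ≡ s * t * κ * β * y * z * (L * L * L)
  regroup = solve-∀

-- (1 + 1/x)^k ≥ 1 + k/x, multiplied through by x^(k+1).
bernoulli : ∀ x k → x ^ k * (x + k) ≤ (x + 1) ^ k * x
bernoulli x zero    = ≤-reflexive (+-identityʳ (x + 0))
bernoulli x (suc k) = begin
  x * x ^ k * (x + suc k)              ≤⟨ m≤m+n _ (x ^ k * k) ⟩
  x * x ^ k * (x + suc k) + x ^ k * k  ≡⟨ identity x (x ^ k) k ⟩
  (x + 1) * (x ^ k * (x + k))          ≤⟨ *-monoʳ-≤ (x + 1) (bernoulli x k) ⟩
  (x + 1) * ((x + 1) ^ k * x)          ≡⟨ *-assoc (x + 1) _ x ⟨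
  (x + 1) * (x + 1) ^ k * x            ∎
  where
  open ≤-Reasoning
  identity : ∀ x y k → x * y * (x + suc k) + y * k ≡ (x + 1) * (y * (x + k))
  identity = solve-∀

2*n^n≤[1+n]^n : ∀ n .{{_ : NonZero n}} → 2 * n ^ n ≤ (1 + n) ^ n
2*n^n≤[1+n]^n n = *-cancelʳ-≤ _ _ n (begin
  2 * n ^ n * n    ≡⟨ double n (n ^ n) ⟩
  n ^ n * (n + n)  ≤⟨ bernoulli n n ⟩
  (n + 1) ^ n * n  ≡⟨ cong (λ x → x ^ n * n) (+-comm n 1) ⟩
  (1 + n) ^ n * n  ∎)
  where
  open ≤-Reasoning
  double : ∀ n y → 2 * y * n ≡ y * (n + n)
  double = solve-∀

multiple-between : ∀ x q .{{_ : NonZero q}} → ∃[ t ] x ≤ t * q × t * q ≤ x + q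
multiple-between x q = suc (x / q) , lower , upper
  where
  lower : x ≤ q + x / q * q
  lower = begin
    x                   ≡⟨ m≡m%n+[m/n]*n x q ⟩
    x % q + x / q * q   ≤⟨ +-monoˡ-≤ _ (<⇒≤ (m%n<n x q)) ⟩
    q + x / q * q       ∎
    where open ≤-Reasoning
  upper : q + x / q * q ≤ x + q
  upper = ≤-trans (+-monoʳ-≤ q (m/n*n≤m x q)) (≤-reflexive (+-comm q x))

-- By recursion on the accessibility proof, as ⌊log2⌋ itself recurses on ⌊ n /2⌋.
2^⌊log2⌋≤1+n : ∀ n (a : Acc _<_ (suc n)) → 2 ^ ⌊log2⌋ (suc n) a ≤ suc n
2^⌊log2⌋≤1+n zero    _        = ≤-refl
2^⌊log2⌋≤1+n (suc n) (acc rs) = begin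
  2 * 2 ^ ⌊log2⌋ (suc ⌊ n /2⌋) _   ≤⟨ *-monoʳ-≤ 2 (2^⌊log2⌋≤1+n ⌊ n /2⌋ _) ⟩
  2 * suc ⌊ n /2⌋                 ≡⟨ *-suc 2 ⌊ n /2⌋ ⟩
  2 + 2 * ⌊ n /2⌋                  ≤⟨ +-monoʳ-≤ 2 twice-half ⟩
  2 + n                           ∎
  where
  open ≤-Reasoning
  twice-half : 2 * ⌊ n /2⌋ ≤ n
  twice-half = begin
    2 * ⌊ n /2⌋           ≡⟨ cong (⌊ n /2⌋ +_) (+-identityʳ _) ⟩
    ⌊ n /2⌋ + ⌊ n /2⌋     ≤⟨ +-monoʳ-≤ ⌊ n /2⌋ (⌊n/2⌋≤⌈n/2⌉ n) ⟩
    ⌊ n /2⌋ + ⌈ n /2⌉     ≡⟨ ⌊n/2⌋+⌈n/2⌉≡n n ⟩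
    n                     ∎

2^⌊log₂n⌋≤n : ∀ n .{{_ : NonZero n}} → 2 ^ ⌊log₂ n ⌋ ≤ n
2^⌊log₂n⌋≤n (suc n) = 2^⌊log2⌋≤1+n n _

2^k≤n⇒k≤⌊log₂n⌋ : ∀ {k n} → 2 ^ k ≤ n → k ≤ ⌊log₂ n ⌋
2^k≤n⇒k≤⌊log₂n⌋ {k} {n} h = subst (_≤ ⌊log₂ n ⌋) (⌊log₂[2^n]⌋≡n k) (⌊log₂⌋-mono-≤ h)

n<2^[1+⌊log₂n⌋] : ∀ n → n < 2 ^ suc ⌊log₂ n ⌋
n<2^[1+⌊log₂n⌋] n = ≰⇒> (λ 2^[1+k]≤n → 1+n≰n (2^k≤n⇒k≤⌊log₂n⌋ {n = n} 2^[1+k]≤n))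

-- Sums over size classes

∑< : ℕ → (ℕ → ℕ) → ℕ
∑< zero    f = 0
∑< (suc n) f = ∑< n f + f n

∑<-mono : ∀ n {f g} → (∀ r → f r ≤ g r) → ∑< n f ≤ ∑< n g
∑<-mono zero    f≤g = z≤n
∑<-mono (suc n) f≤g = +-mono-≤ (∑<-mono n f≤g) (f≤g n)

∑<-bump : ∀ n {f g a ρ} → (∀ r → f r ≤ g r) → ρ < n → a + f ρ ≤ g ρ → a + ∑< n f ≤ ∑< n g
∑<-bump (suc n) {f} {g} {a} {ρ} f≤g ρ<1+n bump with ρ ≟ n
... | yes refl = begin
  a + (∑< n f + f ρ)  ≡⟨ x+[y+z]≡y+[x+z] a (∑< n f) (f ρ) ⟩
  ∑< n f + (a + f ρ)  ≤⟨ +-mono-≤ (∑<-mono n f≤g) bump ⟩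
  ∑< n g + g ρ        ∎
  where
  open ≤-Reasoning
  x+[y+z]≡y+[x+z] : ∀ x y z → x + (y + z) ≡ y + (x + z)
  x+[y+z]≡y+[x+z] = solve-∀
... | no ρ≢n = ≤-trans (≤-reflexive (sym (+-assoc a _ _)))
  (+-mono-≤ (∑<-bump n f≤g (≤∧≢⇒< (≤-pred ρ<1+n) ρ≢n) bump) (f≤g n))

∑<-≤-* : ∀ n {f M} → (∀ r → r < n → f r ≤ M) → ∑< n f ≤ n * M
∑<-≤-* zero    _   = z≤n
∑<-≤-* (suc n) {f} {M} f≤M = ≤-trans
  (+-mono-≤ (∑<-≤-* n (λ r r<n → f≤M r (m<n⇒m<1+n r<n))) (f≤M n ≤-refl))
  (≤-reflexive (+-comm (n * M) M))

⊔-preserves-^-≤ : ∀ q {a b Y} → a ^ q ≤ Y → b ^ q ≤ Y → (a ⊔ b) ^ q ≤ Y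
⊔-preserves-^-≤ q {a} {b} a^q≤Y b^q≤Y with ⊔-sel a b
... | inj₁ eq rewrite eq = a^q≤Y
... | inj₂ eq rewrite eq = b^q≤Y

∃-max-^-≤ : ∀ n q {f : ℕ → ℕ} {Y} → 0 < q → (∀ r → r < n → f r ^ q ≤ Y) →
            ∃[ M ] M ^ q ≤ Y × (∀ r → r < n → f r ≤ M)
∃-max-^-≤ zero    (suc q) _ _ = 0 , z≤n , λ _ ()
∃-max-^-≤ (suc n) q {f} {Y} 0<q f^q≤Y
  with M , M^q≤Y , f≤M ← ∃-max-^-≤ n q {f} 0<q (λ r r<n → f^q≤Y r (m<n⇒m<1+n r<n)) =
  M ⊔ f n , ⊔-preserves-^-≤ q M^q≤Y (f^q≤Y n ≤-refl) , f≤max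
  where
  f≤max : ∀ r → r < suc n → f r ≤ M ⊔ f n
  f≤max r r<1+n with r ≟ n
  ... | yes refl = m≤n⊔m M (f r)
  ... | no r≢n   = ≤-trans (f≤M r (≤∧≢⇒< (≤-pred r<1+n) r≢n)) (m≤m⊔n M (f n))

∑<-^-≤ : ∀ n q {f Y} → 0 < q → (∀ r → r < n → f r ^ q ≤ Y) → ∑< n f ^ q ≤ n ^ q * Y
∑<-^-≤ n q {f} {Y} 0<q f^q≤Y with M , M^q≤Y , f≤M ← ∃-max-^-≤ n q {f} 0<q f^q≤Y = begin
  ∑< n f ^ q   ≤⟨ ^-monoˡ-≤ q (∑<-≤-* n f≤M) ⟩
  (n * M) ^ q  ≡⟨ ^-distribʳ-* n M q ⟩
  n ^ q * M ^ q ≤⟨ *-monoʳ-≤ (n ^ q) M^q≤Y ⟩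
  n ^ q * Y    ∎
  where open ≤-Reasoning

module _ {A : Set} (b : A → ℕ) where

  fibreSize : ℕ → List A → ℕ
  fibreSize r xs = length (filter (λ x → b x ≟ r) xs)

  fibreSize-∷-hit : ∀ {r} x xs → b x ≡ r → fibreSize r (x ∷ xs) ≡ suc (fibreSize r xs)
  fibreSize-∷-hit {r} x xs bx≡r = cong length (filter-accept (λ y → b y ≟ r) bx≡r)

  fibreSize-∷-miss : ∀ {r} x xs → b x ≢ r → fibreSize r (x ∷ xs) ≡ fibreSize r xs
  fibreSize-∷-miss {r} x xs bx≢r = cong length (filter-reject (λ y → b y ≟ r) bx≢r)

  fibreSize-∷-≤ : ∀ r x xs → fibreSize r xs ≤ fibreSize r (x ∷ xs)
  fibreSize-∷-≤ r x xs with b x ≟ r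
  ... | yes bx≡r = ≤-trans (n≤1+n _) (≤-reflexive (sym (fibreSize-∷-hit x xs bx≡r)))
  ... | no  bx≢r = ≤-reflexive (sym (fibreSize-∷-miss x xs bx≢r))

  fibreSize-weight : ∀ (w : ℕ → ℕ) (v : A → ℕ) r {xs} → All (λ x → w (b x) ≤ v x) xs →
                     w r * fibreSize r xs ≤ sum (map v xs)
  fibreSize-weight w v r []                  = ≤-reflexive (*-zeroʳ (w r))
  fibreSize-weight w v r {x ∷ xs} (wx≤vx ∷ ws) with b x ≟ r
  ... | yes refl = begin
    w (b x) * fibreSize (b x) (x ∷ xs)      ≡⟨ cong (w (b x) *_) (fibreSize-∷-hit x xs refl) ⟩
    w (b x) * suc (fibreSize (b x) xs)      ≡⟨ *-suc (w (b x)) _ ⟩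
    w (b x) + w (b x) * fibreSize (b x) xs  ≤⟨ +-mono-≤ wx≤vx (fibreSize-weight w v (b x) ws) ⟩
    v x + sum (map v xs)                    ∎
    where open ≤-Reasoning
  ... | no bx≢r = begin
    w r * fibreSize r (x ∷ xs)  ≡⟨ cong (w r *_) (fibreSize-∷-miss x xs bx≢r) ⟩
    w r * fibreSize r xs        ≤⟨ fibreSize-weight w v r ws ⟩
    sum (map v xs)              ≤⟨ m≤n+m _ (v x) ⟩
    v x + sum (map v xs)        ∎
    where open ≤-Reasoning

  sum-≤-∑<-fibres : ∀ ℓ (f : A → ℕ) (g : ℕ → ℕ) {xs} → All (λ x → b x < ℓ × f x ≤ g (b x)) xs →
                    sum (map f xs) ≤ ∑< ℓ (λ r → g r * fibreSize r xs)
  sum-≤-∑<-fibres ℓ f g []                               = z≤n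
  sum-≤-∑<-fibres ℓ f g {x ∷ xs} ((bx<ℓ , fx≤gbx) ∷ hs) = begin
    f x + sum (map f xs)                           ≤⟨ +-monoʳ-≤ (f x) (sum-≤-∑<-fibres ℓ f g hs) ⟩
    f x + ∑< ℓ (λ r → g r * fibreSize r xs)        ≤⟨ ∑<-bump ℓ grow bx<ℓ bump ⟩
    ∑< ℓ (λ r → g r * fibreSize r (x ∷ xs))        ∎
    where
    open ≤-Reasoning
    grow : ∀ r → g r * fibreSize r xs ≤ g r * fibreSize r (x ∷ xs)
    grow r = *-monoʳ-≤ (g r) (fibreSize-∷-≤ r x xs)
    bump : f x + g (b x) * fibreSize (b x) xs ≤ g (b x) * fibreSize (b x) (x ∷ xs)
    bump = begin
      f x + g (b x) * fibreSize (b x) xs          ≤⟨ +-monoˡ-≤ _ fx≤gbx ⟩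
      g (b x) + g (b x) * fibreSize (b x) xs      ≡⟨ *-suc (g (b x)) _ ⟨
      g (b x) * suc (fibreSize (b x) xs)          ≡⟨ cong (g (b x) *_) (fibreSize-∷-hit x xs refl) ⟨
      g (b x) * fibreSize (b x) (x ∷ xs)          ∎

dyadic-term-≤ : ∀ p q c t r N A B → p ≤ q → t * q ≤ suc r * p + q → N ≤ A → 2 ^ r * N ≤ B →
                (c * 2 ^ t * N) ^ q ≤ c ^ q * 2 ^ p * 2 ^ q * A ^ (q ∸ p) * B ^ p
dyadic-term-≤ p q c t r N A B p≤q tq≤ N≤A 2^rN≤B = begin
  (c * 2 ^ t * N) ^ q
    ≡⟨ trans (^-distribʳ-* (c * 2 ^ t) N q) (cong (_* N ^ q) (^-distribʳ-* c (2 ^ t) q)) ⟩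
  c ^ q * (2 ^ t) ^ q * N ^ q
    ≤⟨ *-monoˡ-≤ (N ^ q) (*-monoʳ-≤ (c ^ q) 2^tq≤) ⟩
  c ^ q * (2 ^ p * (2 ^ r) ^ p * 2 ^ q) * N ^ q
    ≡⟨ cong (c ^ q * (2 ^ p * (2 ^ r) ^ p * 2 ^ q) *_) (^-∸-split N p≤q) ⟨
  c ^ q * (2 ^ p * (2 ^ r) ^ p * 2 ^ q) * (N ^ (q ∸ p) * N ^ p)
    ≡⟨ rearrange (c ^ q) (2 ^ p) ((2 ^ r) ^ p) (2 ^ q) (N ^ (q ∸ p)) (N ^ p) ⟩
  c ^ q * 2 ^ p * 2 ^ q * N ^ (q ∸ p) * ((2 ^ r) ^ p * N ^ p)
    ≡⟨ cong (c ^ q * 2 ^ p * 2 ^ q * N ^ (q ∸ p) *_) (^-distribʳ-* (2 ^ r) N p) ⟨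
  c ^ q * 2 ^ p * 2 ^ q * N ^ (q ∸ p) * (2 ^ r * N) ^ p
    ≤⟨ *-mono-≤ (*-monoʳ-≤ (c ^ q * 2 ^ p * 2 ^ q) (^-monoˡ-≤ (q ∸ p) N≤A)) (^-monoˡ-≤ p 2^rN≤B) ⟩
  c ^ q * 2 ^ p * 2 ^ q * A ^ (q ∸ p) * B ^ p
    ∎
  where
  open ≤-Reasoning
  2^tq≤ : (2 ^ t) ^ q ≤ 2 ^ p * (2 ^ r) ^ p * 2 ^ q
  2^tq≤ = begin
    (2 ^ t) ^ q               ≡⟨ ^-*-assoc 2 t q ⟩
    2 ^ (t * q)               ≤⟨ ^-monoʳ-≤ 2 tq≤ ⟩
    2 ^ (suc r * p + q)       ≡⟨ ^-distribˡ-+-* 2 (suc r * p) q ⟩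
    2 ^ (suc r * p) * 2 ^ q   ≡⟨ cong (_* 2 ^ q) (^-*-assoc 2 (suc r) p) ⟨
    (2 * 2 ^ r) ^ p * 2 ^ q   ≡⟨ cong (_* 2 ^ q) (^-distribʳ-* 2 (2 ^ r) p) ⟩
    2 ^ p * (2 ^ r) ^ p * 2 ^ q ∎
  rearrange : ∀ a b x y u v → a * (b * x * y) * (u * v) ≡ a * b * y * u * (x * v)
  rearrange = solve-∀

SeparatedRegion : (p q c M : ℕ) → ℕ × ℕ → Set
SeparatedRegion p q c M (e , s) = 0 < e × e ≤ M × SepBound p q c e s

module _ (p q c M : ℕ) .{{_ : NonZero q}} where

  private
    -- t with (r+1)p ≤ tq ≤ (r+1)p + q, so that (2^t)^q bounds |E(H)|^p when ⌊log₂|E(H)|⌋ = r.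
    exponent : ℕ → ℕ
    exponent r = proj₁ (multiple-between (suc r * p) q)

    level : ℕ × ℕ → ℕ
    level (e , _) = ⌊log₂ e ⌋

    separator-≤ : ∀ {e s} → SepBound p q c e s → s ≤ c * 2 ^ exponent ⌊log₂ e ⌋
    separator-≤ {e} sb = sb (2 ^ exponent ρ) (begin
      e ^ p                 ≤⟨ ^-monoˡ-≤ p (<⇒≤ (n<2^[1+⌊log₂n⌋] e)) ⟩
      (2 ^ suc ρ) ^ p       ≡⟨ ^-*-assoc 2 (suc ρ) p ⟩
      2 ^ (suc ρ * p)       ≤⟨ ^-monoʳ-≤ 2 (proj₁ (proj₂ (multiple-between (suc ρ * p) q))) ⟩
      2 ^ (exponent ρ * q)  ≡⟨ ^-*-assoc 2 (exponent ρ) q ⟨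
      (2 ^ exponent ρ) ^ q  ∎)
      where
      open ≤-Reasoning
      ρ = ⌊log₂ e ⌋

  separators-sum-^-≤ : ∀ {A B} → p ≤ q → ∀ {es} → All (SeparatedRegion p q c M) es →
    length es ≤ A → sum (map proj₁ es) ≤ B →
    sum (map proj₂ es) ^ q ≤ suc ⌊log₂ M ⌋ ^ q * (c ^ q * 2 ^ p * 2 ^ q * A ^ (q ∸ p) * B ^ p)
  separators-sum-^-≤ {A} {B} p≤q {es} regions len≤A sum≤B = begin
    sum (map proj₂ es) ^ q      ≤⟨ ^-monoˡ-≤ q (sum-≤-∑<-fibres level ℓ proj₂ g (All.map bucketed regions)) ⟩
    ∑< ℓ (λ r → g r * N r) ^ q  ≤⟨ ∑<-^-≤ ℓ q (>-nonZero⁻¹ q) term-≤ ⟩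
    ℓ ^ q * (c ^ q * 2 ^ p * 2 ^ q * A ^ (q ∸ p) * B ^ p) ∎
    where
    open ≤-Reasoning
    ℓ = suc ⌊log₂ M ⌋
    g : ℕ → ℕ
    g r = c * 2 ^ exponent r
    N : ℕ → ℕ
    N r = fibreSize level r es
    bucketed : ∀ {region} → SeparatedRegion p q c M region → level region < ℓ × proj₂ region ≤ g (level region)
    bucketed (_ , e≤M , sb) = s≤s (⌊log₂⌋-mono-≤ e≤M) , separator-≤ sb
    term-≤ : ∀ r → r < ℓ → (g r * N r) ^ q ≤ c ^ q * 2 ^ p * 2 ^ q * A ^ (q ∸ p) * B ^ p
    term-≤ r _ = dyadic-term-≤ p q c (exponent r) r (N r) A B p≤q
      (proj₂ (proj₂ (multiple-between (suc r * p) q)))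
      (≤-trans (length-filter _ es) len≤A)
      (≤-trans (fibreSize-weight level (2 ^_) proj₁ r (All.map 2^level≤size regions)) sum≤B)
      where
      2^level≤size : ∀ {region} → SeparatedRegion p q c M region → 2 ^ level region ≤ proj₁ region
      2^level≤size {suc _ , _} _ = 2^⌊log₂n⌋≤n _

-- Cardinalities of subsets

+-suc-cong : ∀ {a b c d} → a + b ≡ c + d → a + suc b ≡ c + suc d
+-suc-cong {a} {b} {c} {d} eq = trans (+-suc a b) (trans (cong suc eq) (sym (+-suc c d)))

∣p∩q∣+∣p∪q∣≡∣p∣+∣q∣ : ∀ {n} (p q : Subset n) → ∣ p ∩ q ∣ + ∣ p ∪ q ∣ ≡ ∣ p ∣ + ∣ q ∣
∣p∩q∣+∣p∪q∣≡∣p∣+∣q∣ []            []            = refl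
∣p∩q∣+∣p∪q∣≡∣p∣+∣q∣ (inside ∷ p)  (inside ∷ q)  = cong suc (+-suc-cong (∣p∩q∣+∣p∪q∣≡∣p∣+∣q∣ p q))
∣p∩q∣+∣p∪q∣≡∣p∣+∣q∣ (inside ∷ p)  (outside ∷ q) = trans (+-suc _ _) (cong suc (∣p∩q∣+∣p∪q∣≡∣p∣+∣q∣ p q))
∣p∩q∣+∣p∪q∣≡∣p∣+∣q∣ (outside ∷ p) (inside ∷ q)  = +-suc-cong (∣p∩q∣+∣p∪q∣≡∣p∣+∣q∣ p q)
∣p∩q∣+∣p∪q∣≡∣p∣+∣q∣ (outside ∷ p) (outside ∷ q) = ∣p∩q∣+∣p∪q∣≡∣p∣+∣q∣ p q

∣p∪q∣≤∣p∣+∣q∣ : ∀ {n} (p q : Subset n) → ∣ p ∪ q ∣ ≤ ∣ p ∣ + ∣ q ∣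
∣p∪q∣≤∣p∣+∣q∣ p q = ≤-trans (m≤n+m _ _) (≤-reflexive (∣p∩q∣+∣p∪q∣≡∣p∣+∣q∣ p q))

∣p∩q∣+∣p∩r∣≤∣p∣+∣q∩r∣ : ∀ {n} (p q r : Subset n) → ∣ p ∩ q ∣ + ∣ p ∩ r ∣ ≤ ∣ p ∣ + ∣ q ∩ r ∣
∣p∩q∣+∣p∩r∣≤∣p∣+∣q∩r∣ p q r = begin
  ∣ p ∩ q ∣ + ∣ p ∩ r ∣                            ≡⟨ ∣p∩q∣+∣p∪q∣≡∣p∣+∣q∣ (p ∩ q) (p ∩ r) ⟨
  ∣ (p ∩ q) ∩ (p ∩ r) ∣ + ∣ (p ∩ q) ∪ (p ∩ r) ∣    ≤⟨ +-mono-≤ (p⊆q⇒∣p∣≤∣q∣ ⊆q∩r) (p⊆q⇒∣p∣≤∣q∣ ⊆p) ⟩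
  ∣ q ∩ r ∣ + ∣ p ∣                                ≡⟨ +-comm ∣ q ∩ r ∣ ∣ p ∣ ⟩
  ∣ p ∣ + ∣ q ∩ r ∣                                ∎
  where
  open ≤-Reasoning
  ⊆q∩r : (p ∩ q) ∩ (p ∩ r) ⊆ q ∩ r
  ⊆q∩r x∈ with x∈p∩q , x∈p∩r ← x∈p∩q⁻ (p ∩ q) (p ∩ r) x∈ =
    x∈p∩q⁺ (proj₂ (x∈p∩q⁻ p q x∈p∩q) , proj₂ (x∈p∩q⁻ p r x∈p∩r))
  ⊆p : (p ∩ q) ∪ (p ∩ r) ⊆ p
  ⊆p x∈ = [ p∩q⊆p p q , p∩q⊆p p r ]′ (x∈p∪q⁻ (p ∩ q) (p ∩ r) x∈)

-- Separator trees

sum-map-++ : ∀ {A : Set} (f : A → ℕ) xs ys → sum (map f (xs ++ ys)) ≡ sum (map f xs) + sum (map f ys)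
sum-map-++ f xs ys = trans (cong sum (map-++ f xs ys)) (sum-++ (map f xs) (map f ys))

+-≤-⊔-* : ∀ h₁ h₂ {a b a′ b′} → a ≤ h₁ * a′ → b ≤ h₂ * b′ → a + b ≤ (h₁ ⊔ h₂) * (a′ + b′)
+-≤-⊔-* h₁ h₂ {a} {b} {a′} {b′} a≤ b≤ = begin
  a + b                            ≤⟨ +-mono-≤ a≤ b≤ ⟩
  h₁ * a′ + h₂ * b′                ≤⟨ +-mono-≤ (*-monoˡ-≤ a′ (m≤m⊔n h₁ h₂)) (*-monoˡ-≤ b′ (m≤n⊔m h₁ h₂)) ⟩
  (h₁ ⊔ h₂) * a′ + (h₁ ⊔ h₂) * b′  ≡⟨ *-distribˡ-+ (h₁ ⊔ h₂) a′ b′ ⟨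
  (h₁ ⊔ h₂) * (a′ + b′)            ∎
  where open ≤-Reasoning

module _ {G : Graph} {p q c bn bd L : ℕ} where

  private
    Tree = SepTree G p q c bn bd L

  leftPos : ∀ {H ∂ D₁ D₂ lt sp} {T₁ : Tree D₁ _} {T₂ : Tree D₂ _} →
            Pos (node {H = H} {∂ = ∂} D₁ D₂ lt sp T₁ T₂) → Maybe (Pos T₁)
  leftPos here      = nothing
  leftPos (left x)  = just x
  leftPos (right _) = nothing

  rightPos : ∀ {H ∂ D₁ D₂ lt sp} {T₁ : Tree D₁ _} {T₂ : Tree D₂ _} →
             Pos (node {H = H} {∂ = ∂} D₁ D₂ lt sp T₁ T₂) → Maybe (Pos T₂)
  rightPos here      = nothing
  rightPos (left _)  = nothing
  rightPos (right x) = just x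

  -- goLeft and goRight are private to Defs; matching on the head position lets Agda
  -- infer them from the goal, so that mapMaybe-cong can replace them on the tail.
  pathCost-node : ∀ {H ∂ D₁ D₂ lt sp} {T₁ : Tree D₁ _} {T₂ : Tree D₂ _} x xs →
    pathCost (node {H = H} {∂ = ∂} D₁ D₂ lt sp T₁ T₂) (x ∷ xs) ≡
    ∣ ∂ ∣ + ∣ Sep G D₁ D₂ ∣ + pathCost T₁ (mapMaybe leftPos (x ∷ xs)) + pathCost T₂ (mapMaybe rightPos (x ∷ xs))
  pathCost-node {∂ = ∂} {D₁} {D₂} {T₁ = T₁} {T₂} here xs =
    cong₂ (λ l r → ∣ ∂ ∣ + ∣ Sep G D₁ D₂ ∣ + pathCost T₁ l + pathCost T₂ r)
      (mapMaybe-cong {g = leftPos} (λ { here → refl ; (left _) → refl ; (right _) → refl }) xs)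
      (mapMaybe-cong {g = rightPos} (λ { here → refl ; (left _) → refl ; (right _) → refl }) xs)
  pathCost-node {∂ = ∂} {D₁} {D₂} {T₁ = T₁} {T₂} (left y) xs =
    cong₂ (λ l r → ∣ ∂ ∣ + ∣ Sep G D₁ D₂ ∣ + pathCost T₁ (y ∷ l) + pathCost T₂ r)
      (mapMaybe-cong {g = leftPos} (λ { here → refl ; (left _) → refl ; (right _) → refl }) xs)
      (mapMaybe-cong {g = rightPos} (λ { here → refl ; (left _) → refl ; (right _) → refl }) xs)
  pathCost-node {∂ = ∂} {D₁} {D₂} {T₁ = T₁} {T₂} (right y) xs =
    cong₂ (λ l r → ∣ ∂ ∣ + ∣ Sep G D₁ D₂ ∣ + pathCost T₁ l + pathCost T₂ (y ∷ r))
      (mapMaybe-cong {g = leftPos} (λ { here → refl ; (left _) → refl ; (right _) → refl }) xs)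
      (mapMaybe-cong {g = rightPos} (λ { here → refl ; (left _) → refl ; (right _) → refl }) xs)

  length-leftPos+rightPos : ∀ {H ∂ D₁ D₂ lt sp} {T₁ : Tree D₁ _} {T₂ : Tree D₂ _}
    (hs : List (Pos (node {H = H} {∂ = ∂} D₁ D₂ lt sp T₁ T₂))) →
    length (mapMaybe leftPos hs) + length (mapMaybe rightPos hs) ≤ length hs
  length-leftPos+rightPos []            = z≤n
  length-leftPos+rightPos (here ∷ hs)    = m≤n⇒m≤1+n (length-leftPos+rightPos hs)
  length-leftPos+rightPos (left _ ∷ hs)  = s≤s (length-leftPos+rightPos hs)
  length-leftPos+rightPos (right _ ∷ hs) = ≤-trans (≤-reflexive (+-suc _ _)) (s≤s (length-leftPos+rightPos hs))

  height : ∀ {H ∂} → Tree H ∂ → ℕ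
  height (leaf _)             = 0
  height (node _ _ _ _ T₁ T₂) = suc (height T₁ ⊔ height T₂)

  -- One entry (|E(H)|, |S(H)|) for every internal node H of 𝓟_T(hs).
  visitedSplits : ∀ {H ∂} (T : Tree H ∂) → List (Pos T) → List (ℕ × ℕ)
  visitedSplits T                            []         = []
  visitedSplits (leaf _)                     (_ ∷ _)    = []
  visitedSplits {H} (node D₁ D₂ _ _ T₁ T₂)   hs@(_ ∷ _) =
    (∣ H ∣ , ∣ Sep G D₁ D₂ ∣) ∷ visitedSplits T₁ (mapMaybe leftPos hs) ++ visitedSplits T₂ (mapMaybe rightPos hs)

  visitedSplits-separated : ∀ {H ∂} (T : Tree H ∂) hs → All (SeparatedRegion p q c (m G)) (visitedSplits T hs)
  visitedSplits-separated T                                   []         = []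
  visitedSplits-separated (leaf _)                            (_ ∷ _)    = []
  visitedSplits-separated {H} (node D₁ D₂ L<∣H∣ sp T₁ T₂)      hs@(_ ∷ _) =
    (≤-trans (s≤s z≤n) L<∣H∣ , ∣p∣≤n H , proj₁ (proj₂ (proj₂ sp)))
    ∷ ++⁺ (visitedSplits-separated T₁ (mapMaybe leftPos hs)) (visitedSplits-separated T₂ (mapMaybe rightPos hs))

  length-visitedSplits≤ : ∀ {H ∂} (T : Tree H ∂) hs → length (visitedSplits T hs) ≤ height T * length hs
  length-visitedSplits≤ T                          []         = z≤n
  length-visitedSplits≤ (leaf _)                   (_ ∷ _)    = z≤n
  length-visitedSplits≤ (node D₁ D₂ _ _ T₁ T₂)     hs@(x ∷ xs) = begin
    suc (length (visitedSplits T₁ ls ++ visitedSplits T₂ rs))            ≡⟨ cong suc (length-++ (visitedSplits T₁ ls)) ⟩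
    suc (length (visitedSplits T₁ ls) + length (visitedSplits T₂ rs))    ≤⟨ s≤s (+-≤-⊔-* (height T₁) (height T₂) (length-visitedSplits≤ T₁ ls) (length-visitedSplits≤ T₂ rs)) ⟩
    suc (h * (length ls + length rs))                                    ≤⟨ s≤s (*-monoʳ-≤ h (length-leftPos+rightPos hs)) ⟩
    suc (h * length hs)                                                  ≤⟨ s≤s (m≤n+m _ (length xs)) ⟩
    suc h * length hs                                                    ∎
    where
    open ≤-Reasoning
    ls = mapMaybe leftPos hs
    rs = mapMaybe rightPos hs
    h  = height T₁ ⊔ height T₂

  ∣D₁∣+∣D₂∣≡∣H∣ : ∀ {H D₁ D₂} → IsSplit G p q c bn bd H D₁ D₂ → ∣ D₁ ∣ + ∣ D₂ ∣ ≡ ∣ H ∣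
  ∣D₁∣+∣D₂∣≡∣H∣ {H} {D₁} {D₂} (D₁∪D₂≡H , D₁∩D₂≡⊥ , _) = begin
    ∣ D₁ ∣ + ∣ D₂ ∣                 ≡⟨ ∣p∩q∣+∣p∪q∣≡∣p∣+∣q∣ D₁ D₂ ⟨
    ∣ D₁ ∩ D₂ ∣ + ∣ D₁ ∪ D₂ ∣       ≡⟨ cong₂ (λ i u → ∣ i ∣ + ∣ u ∣) D₁∩D₂≡⊥ D₁∪D₂≡H ⟩
    ∣ ⊥ {m G} ∣ + ∣ H ∣             ≡⟨ cong (_+ ∣ H ∣) (∣⊥∣≡0 (m G)) ⟩
    ∣ H ∣                           ∎
    where open ≡-Reasoning

  sum-visitedSizes≤ : ∀ {H ∂} (T : Tree H ∂) hs → sum (map proj₁ (visitedSplits T hs)) ≤ height T * ∣ H ∣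
  sum-visitedSizes≤ T                              []         = z≤n
  sum-visitedSizes≤ (leaf _)                       (_ ∷ _)    = z≤n
  sum-visitedSizes≤ {H} (node D₁ D₂ _ sp T₁ T₂)    hs@(_ ∷ _) = begin
    ∣ H ∣ + sum (map proj₁ (visitedSplits T₁ ls ++ visitedSplits T₂ rs))
      ≡⟨ cong (∣ H ∣ +_) (sum-map-++ proj₁ (visitedSplits T₁ ls) _) ⟩
    ∣ H ∣ + (sum (map proj₁ (visitedSplits T₁ ls)) + sum (map proj₁ (visitedSplits T₂ rs)))
      ≤⟨ +-monoʳ-≤ ∣ H ∣ (+-≤-⊔-* (height T₁) (height T₂) (sum-visitedSizes≤ T₁ ls) (sum-visitedSizes≤ T₂ rs)) ⟩
    ∣ H ∣ + h * (∣ D₁ ∣ + ∣ D₂ ∣)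
      ≡⟨ cong (λ e → ∣ H ∣ + h * e) (∣D₁∣+∣D₂∣≡∣H∣ sp) ⟩
    suc h * ∣ H ∣
      ∎
    where
    open ≤-Reasoning
    ls = mapMaybe leftPos hs
    rs = mapMaybe rightPos hs
    h  = height T₁ ⊔ height T₂

  child-boundaries≤ : ∀ ∂ D₁ D₂ → ∣ (∂ ∪ Sep G D₁ D₂) ∩ V G D₁ ∣ + ∣ (∂ ∪ Sep G D₁ D₂) ∩ V G D₂ ∣ ≤ ∣ ∂ ∣ + ∣ Sep G D₁ D₂ ∣ + ∣ Sep G D₁ D₂ ∣
  child-boundaries≤ ∂ D₁ D₂ = ≤-trans (∣p∩q∣+∣p∩r∣≤∣p∣+∣q∩r∣ (∂ ∪ Sep G D₁ D₂) (V G D₁) (V G D₂))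
                                (+-monoˡ-≤ _ (∣p∪q∣≤∣p∣+∣q∣ ∂ (Sep G D₁ D₂)))

  pathCost≤ : ∀ {H ∂} (T : Tree H ∂) hs →
              pathCost T hs ≤ suc (height T) * (∣ ∂ ∣ + 2 * sum (map proj₂ (visitedSplits T hs)))
  pathCost≤ T                            []          = z≤n
  pathCost≤ (leaf _)                     (_ ∷ _)     = m≤m+n _ 0
  pathCost≤ {∂ = ∂} (node D₁ D₂ _ _ T₁ T₂) hs@(x ∷ xs) = begin
    pathCost (node D₁ D₂ _ _ T₁ T₂) hs   ≡⟨ pathCost-node x xs ⟩
    ∣ ∂ ∣ + s + P₁ + P₂                  ≡⟨ +-assoc (∣ ∂ ∣ + s) P₁ P₂ ⟩
    ∣ ∂ ∣ + s + (P₁ + P₂)                ≤⟨ +-mono-≤ parent≤ (+-≤-⊔-* (suc (height T₁)) (suc (height T₂)) (pathCost≤ T₁ ls) (pathCost≤ T₂ rs)) ⟩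
    X + suc h * (X₁ + X₂)                ≤⟨ +-monoʳ-≤ X (*-monoʳ-≤ (suc h) children≤) ⟩
    suc (suc h) * X                      ≡⟨ cong (λ e → suc (suc h) * (∣ ∂ ∣ + 2 * (s + e))) (sum-map-++ proj₂ (visitedSplits T₁ ls) _) ⟨
    suc (suc h) * (∣ ∂ ∣ + 2 * sum (map proj₂ (visitedSplits (node D₁ D₂ _ _ T₁ T₂) hs))) ∎
    where
    open ≤-Reasoning
    ls = mapMaybe leftPos hs
    rs = mapMaybe rightPos hs
    h  = height T₁ ⊔ height T₂
    s  = ∣ Sep G D₁ D₂ ∣
    P₁ = pathCost T₁ ls
    P₂ = pathCost T₂ rs
    Σ₁ = sum (map proj₂ (visitedSplits T₁ ls))
    Σ₂ = sum (map proj₂ (visitedSplits T₂ rs))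
    b₁ = ∣ (∂ ∪ Sep G D₁ D₂) ∩ V G D₁ ∣
    b₂ = ∣ (∂ ∪ Sep G D₁ D₂) ∩ V G D₂ ∣
    X₁ = b₁ + 2 * Σ₁
    X₂ = b₂ + 2 * Σ₂
    X  = ∣ ∂ ∣ + 2 * (s + (Σ₁ + Σ₂))
    parent≤ : ∣ ∂ ∣ + s ≤ X
    parent≤ = +-monoʳ-≤ ∣ ∂ ∣ (≤-trans (m≤m+n s (Σ₁ + Σ₂)) (m≤m+n _ _))
    children≤ : X₁ + X₂ ≤ X
    children≤ = begin
      X₁ + X₂                                     ≡⟨ regroup b₁ Σ₁ b₂ Σ₂ ⟩
      (b₁ + b₂) + 2 * (Σ₁ + Σ₂)                   ≤⟨ +-monoˡ-≤ _ (child-boundaries≤ ∂ D₁ D₂) ⟩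
      ∣ ∂ ∣ + s + s + 2 * (Σ₁ + Σ₂)               ≡⟨ collect ∣ ∂ ∣ s (Σ₁ + Σ₂) ⟩
      X                                           ∎
      where
      regroup : ∀ b₁ Σ₁ b₂ Σ₂ → b₁ + 2 * Σ₁ + (b₂ + 2 * Σ₂) ≡ (b₁ + b₂) + 2 * (Σ₁ + Σ₂)
      regroup = solve-∀
      collect : ∀ d s σ → d + s + s + 2 * σ ≡ d + 2 * (s + σ)
      collect = solve-∀

  balanced-step : ∀ k {x y} → bd ^ k ≤ bn ^ k * x → bd * x ≤ bn * y → bd ^ suc k ≤ bn ^ suc k * y
  balanced-step k {x} {y} bd^k≤ bdx≤ = begin
    bd * bd ^ k          ≤⟨ *-monoʳ-≤ bd bd^k≤ ⟩
    bd * (bn ^ k * x)    ≡⟨ x*[y*z]≡y*[x*z] bd (bn ^ k) x ⟩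
    bn ^ k * (bd * x)    ≤⟨ *-monoʳ-≤ (bn ^ k) bdx≤ ⟩
    bn ^ k * (bn * y)    ≡⟨ x*[y*z]≡y*[x*z] (bn ^ k) bn y ⟩
    bn * (bn ^ k * y)    ≡⟨ *-assoc bn (bn ^ k) y ⟨
    bn * bn ^ k * y      ∎
    where
    open ≤-Reasoning
    x*[y*z]≡y*[x*z] : ∀ x y z → x * (y * z) ≡ y * (x * z)
    x*[y*z]≡y*[x*z] = solve-∀

  bd^k≤bn^k*∣H∣ : ∀ {H ∂} (T : Tree H ∂) k → k < height T → bd ^ k ≤ bn ^ k * ∣ H ∣
  bd^k≤bn^k*∣H∣ (node D₁ D₂ L<∣H∣ _ _ _) zero _ = ≤-trans (≤-trans (s≤s z≤n) L<∣H∣) (≤-reflexive (sym (*-identityˡ _)))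
  bd^k≤bn^k*∣H∣ (node D₁ D₂ _ (_ , _ , _ , bd∣D₁∣≤ , bd∣D₂∣≤) T₁ T₂) (suc k) (s≤s k<h)
    with ≤-total (height T₁) (height T₂)
  ... | inj₁ h₁≤h₂ = balanced-step k (bd^k≤bn^k*∣H∣ T₂ k (subst (k <_) (m≤n⇒m⊔n≡n h₁≤h₂) k<h)) bd∣D₂∣≤
  ... | inj₂ h₂≤h₁ = balanced-step k (bd^k≤bn^k*∣H∣ T₁ k (subst (k <_) (m≥n⇒m⊔n≡m h₂≤h₁) k<h)) bd∣D₁∣≤

  height≤ : 0 < bn → bn < bd → ∀ {H ∂} (T : Tree H ∂) → height T ≤ bn * suc ⌊log₂ ∣ H ∣ ⌋
  height≤ 0<bn bn<bd {H} T = ≮⇒≥ too-high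
    where
    instance
      bn≢0 : NonZero bn
      bn≢0 = >-nonZero 0<bn
    ℓ = suc ⌊log₂ ∣ H ∣ ⌋
    k = bn * ℓ
    2^ℓ*bn^k≤bd^k : 2 ^ ℓ * bn ^ k ≤ bd ^ k
    2^ℓ*bn^k≤bd^k = begin
      2 ^ ℓ * bn ^ k           ≡⟨ cong (2 ^ ℓ *_) (^-*-assoc bn bn ℓ) ⟨
      2 ^ ℓ * (bn ^ bn) ^ ℓ    ≡⟨ ^-distribʳ-* 2 (bn ^ bn) ℓ ⟨
      (2 * bn ^ bn) ^ ℓ        ≤⟨ ^-monoˡ-≤ ℓ (≤-trans (2*n^n≤[1+n]^n bn) (^-monoˡ-≤ bn bn<bd)) ⟩
      (bd ^ bn) ^ ℓ            ≡⟨ ^-*-assoc bd bn ℓ ⟩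
      bd ^ k                   ∎
      where open ≤-Reasoning
    too-high : ¬ (k < height T)
    too-high k<h = 1+n≰n (2^k≤n⇒k≤⌊log₂n⌋ 2^ℓ≤∣H∣)
      where
      2^ℓ≤∣H∣ : 2 ^ ℓ ≤ ∣ H ∣
      2^ℓ≤∣H∣ = *-cancelʳ-≤ _ _ (bn ^ k) {{m^n≢0 bn k}}
        (≤-trans 2^ℓ*bn^k≤bd^k (≤-trans (bd^k≤bn^k*∣H∣ T k k<h) (≤-reflexive (*-comm (bn ^ k) ∣ H ∣))))

lemma9p3 : ∀ (p q : ℕ) → 0 < p → p < q →
    ∀ (c bn bd L : ℕ) → 0 < c → 0 < bn → bn < bd →
    ∃[ C ] ∃[ d ]
      (∀ (G : Graph) → Separable G p q c bn bd →
        (T : SepTree G p q c bn bd L ⊤ ⊥) →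
        (𝓗 : List (Pos T)) → Unique 𝓗 →
        pathCost T 𝓗 ^ q ≤ C * length 𝓗 ^ (q ∸ p) * m G ^ p * suc ⌊log₂ m G ⌋ ^ d)
lemma9p3 p q 0<p p<q c bn bd L _ 0<bn bn<bd = suc bn ^ q * 2 ^ q * κ * bn ^ q , q + q + q , bound
  where
  κ = c ^ q * 2 ^ p * 2 ^ q
  instance
    q≢0 : NonZero q
    q≢0 = >-nonZero (<-trans 0<p p<q)
  bound : ∀ G → Separable G p q c bn bd → (T : SepTree G p q c bn bd L ⊤ ⊥) → (𝓗 : List (Pos T)) → Unique 𝓗 →
          pathCost T 𝓗 ^ q ≤ suc bn ^ q * 2 ^ q * κ * bn ^ q * length 𝓗 ^ (q ∸ p) * m G ^ p * suc ⌊log₂ m G ⌋ ^ (q + q + q)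
  bound G _ T 𝓗 _ = begin
    pathCost T 𝓗 ^ q
      ≤⟨ ^-monoˡ-≤ q cost≤ ⟩
    (suc h * (2 * S)) ^ q
      ≡⟨ trans (^-distribʳ-* (suc h) (2 * S) q) (cong (suc h ^ q *_) (^-distribʳ-* 2 S q)) ⟩
    suc h ^ q * (2 ^ q * S ^ q)
      ≤⟨ *-monoʳ-≤ (suc h ^ q) (*-monoʳ-≤ (2 ^ q) S^q≤) ⟩
    suc h ^ q * (2 ^ q * (ℓ ^ q * (κ * (h ^ q * (K ^ (q ∸ p) * m G ^ p)))))
      ≤⟨ height-elimination q κ bn ℓ h (K ^ (q ∸ p)) (m G ^ p) h≤bnℓ (s≤s z≤n) ⟩
    suc bn ^ q * 2 ^ q * κ * bn ^ q * K ^ (q ∸ p) * m G ^ p * ℓ ^ (q + q + q)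
      ∎
    where
    open ≤-Reasoning
    ℓ = suc ⌊log₂ m G ⌋
    h = height T
    K = length 𝓗
    S = sum (map proj₂ (visitedSplits T 𝓗))
    cost≤ : pathCost T 𝓗 ≤ suc h * (2 * S)
    cost≤ = subst (λ b → pathCost T 𝓗 ≤ suc h * (b + 2 * S)) (∣⊥∣≡0 (n G)) (pathCost≤ T 𝓗)
    h≤bnℓ : h ≤ bn * ℓ
    h≤bnℓ = subst (λ e → h ≤ bn * suc ⌊log₂ e ⌋) (∣⊤∣≡n (m G)) (height≤ 0<bn bn<bd T)
    S^q≤ : S ^ q ≤ ℓ ^ q * (κ * (h ^ q * (K ^ (q ∸ p) * m G ^ p)))
    S^q≤ = begin
      S ^ q  ≤⟨ separators-sum-^-≤ p q c (m G) (<⇒≤ p<q) (visitedSplits-separated T 𝓗) (length-visitedSplits≤ T 𝓗)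
                  (subst (λ e → sum (map proj₁ (visitedSplits T 𝓗)) ≤ h * e) (∣⊤∣≡n (m G)) (sum-visitedSizes≤ T 𝓗)) ⟩
      ℓ ^ q * (κ * (h * K) ^ (q ∸ p) * (h * m G) ^ p)
        ≡⟨ cong (ℓ ^ q *_) (trans (*-assoc κ _ _) (cong (κ *_) ([x*y]^[q∸p]*[x*z]^p h K (m G) (<⇒≤ p<q)))) ⟩
      ℓ ^ q * (κ * (h ^ q * (K ^ (q ∸ p) * m G ^ p)))  ∎
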